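{- Let $k\ge 1$ be an integer and for $j\ge 0$ let $C_{k,2}(j)=\frac{1}{2j+1}\binom{(2j+1)k}{j}$. Then for every $n\ge 1$, $$C_{k,2}(n)=\sum_{i=1}^{n}\frac{(2i-1)k-(i-1)}{i}\,C_{k,2}(i-1)\,C_{k,2}(n-i).$$ -}

module Defs where

open import Data.Nat using (ℕ; zero; suc; _+_; _*_)
open import Data.Nat.Combinatorics using (_C_)
open import Data.Integer using (ℤ; +_) renaming (_*_ to _ℤ*_; _-_ to _ℤ-_)
open import Data.Rational using (ℚ; _/_) renaming (_+_ to _ℚ+_; _*_ to _ℚ*_)
import Data.Rational as ℚ

Ck2 : ℕ → ℕ → ℚ
Ck2 k j = (+ ((suc (2 * j) * k) C j)) / suc (2 * j)

sumFrom1 : ℕ → (ℕ → ℚ) → ℚ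
sumFrom1 zero    f = ℚ.0ℚ
sumFrom1 (suc n) f = sumFrom1 n f ℚ+ f (suc n)

-- the coefficient ((2i-1)k - (i-1)) / i, for i ≥ 1, written with i = suc m
-- (so 2i-1 = 2m+1 and i-1 = m), computed in ℤ to avoid truncated subtraction
coeff : ℕ → ℕ → ℚ
coeff k zero    = ℚ.0ℚ   -- never used (i ranges over 1..n)
coeff k (suc m) = ((+ (suc (2 * m) * k)) ℤ- (+ m)) / suc m

-- The Rothe polynomials A_n(x) = x/(x+nz) · C(x+nz, n) are determined on ℤ by A_0 = 1,
-- A_{n+1}(0) = 0 and A_{n+1}(x+1) = A_{n+1}(x) + A_n(x+z), and from this recursion alone
-- they satisfy the convolution identity A_n(x+y) = Σ_i A_i(x) A_{n-i}(y).  For z = 2k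
-- the closed form gives A_j(k) = C_{k,2}(j) and -A_i(-k) = ((2i-1)k-(i-1))/i · C_{k,2}(i-1),
-- so the convolution at x = -k, y = k, where A_{n}(0) = 0 for n ≥ 1, is the recurrence.
module Submission where

open import Defs
open import Data.Nat as ℕ using (ℕ; zero; suc; _≥_; _∸_; NonZero)
import Data.Nat.Properties as ℕ
open import Data.Nat.Combinatorics using (_C_; nC1≡n; nCk+nC[k+1]≡[n+1]C[k+1])
open import Data.Integer using (ℤ; +_; -[1+_]; 0ℤ; 1ℤ; _+_; _*_; _-_; -_)
import Data.Integer.Properties as ℤ
open import Data.Integer.Tactic.RingSolver using (solve-∀; solve)
open import Data.List using (_∷_; [])
open import Data.Rational using (ℚ; _/_; fromℚᵘ) renaming (_*_ to _ℚ*_; _+_ to _ℚ+_)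
import Data.Rational.Properties as ℚ
open import Data.Rational.Unnormalised as ℚᵘ using (mkℚᵘ; *≡*)
import Data.Rational.Unnormalised.Properties as ℚᵘ
open import Algebra.Properties.AbelianGroup ℤ.+-0-abelianGroup using (∙-cancelˡ; ∙-cancelʳ; inverseˡ-unique)
open import Algebra.Properties.CommutativeSemigroup ℤ.+-commutativeSemigroup using (interchange)
open import Algebra.Properties.CommutativeSemigroup ℤ.*-commutativeSemigroup using (x∙yz≈yx∙z)
open import Function using (_∘_)
open import Relation.Binary.PropositionalEquality
open ≡-Reasoning

ℤ-induction : ∀ {ℓ} (P : ℤ → Set ℓ) → P 0ℤ →
              (∀ n → P (+ n) → P (+ n + 1ℤ)) →
              (∀ n → P (-[1+ n ] + 1ℤ) → P -[1+ n ]) →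
              ∀ x → P x
ℤ-induction P p₀ up down (+ zero)      = p₀
ℤ-induction P p₀ up down (+ suc n)     =
  subst P (cong +_ (ℕ.+-comm n 1)) (up n (ℤ-induction P p₀ up down (+ n)))
ℤ-induction P p₀ up down -[1+ zero ]   = down 0 p₀
ℤ-induction P p₀ up down -[1+ suc n ]  = down (suc n) (ℤ-induction P p₀ up down -[1+ n ])

antidiff : (ℤ → ℤ) → ℤ → ℤ
antidiff f (+ zero)         = 0ℤ
antidiff f (+ suc n)        = antidiff f (+ n) + f (+ n)
antidiff f -[1+ zero ]      = - f -[1+ 0 ]
antidiff f -[1+ suc n ]     = antidiff f -[1+ n ] - f -[1+ suc n ]

antidiff-step : ∀ f x → antidiff f (x + 1ℤ) ≡ antidiff f x + f x
antidiff-step f (+ n)          = cong (antidiff f ∘ +_) (ℕ.+-comm n 1)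
antidiff-step f -[1+ zero ]    = sym (ℤ.+-inverseˡ (f -[1+ 0 ]))
antidiff-step f -[1+ suc n ]   = sym (minus-plus (antidiff f -[1+ n ]) (f -[1+ suc n ]))
  where
  minus-plus : ∀ a b → (a - b) + b ≡ a
  minus-plus = solve-∀

sumFrom0 : ℕ → (ℕ → ℤ) → ℤ
sumFrom0 zero    f = f 0
sumFrom0 (suc n) f = sumFrom0 n f + f (suc n)

sumFrom0-suc : ∀ n f → sumFrom0 (suc n) f ≡ f 0 + sumFrom0 n (f ∘ suc)
sumFrom0-suc zero    f = refl
sumFrom0-suc (suc n) f = trans (cong (_+ f (suc (suc n))) (sumFrom0-suc n f))
                               (ℤ.+-assoc (f 0) (sumFrom0 n (f ∘ suc)) (f (suc (suc n))))

sumFrom0-cong : ∀ n {f g} → (∀ i → f i ≡ g i) → sumFrom0 n f ≡ sumFrom0 n g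
sumFrom0-cong zero    f≗g = f≗g 0
sumFrom0-cong (suc n) f≗g = cong₂ _+_ (sumFrom0-cong n f≗g) (f≗g (suc n))

sumFrom0-+ : ∀ n f g → sumFrom0 n (λ i → f i + g i) ≡ sumFrom0 n f + sumFrom0 n g
sumFrom0-+ zero    f g = refl
sumFrom0-+ (suc n) f g = trans (cong (_+ (f (suc n) + g (suc n))) (sumFrom0-+ n f g))
                               (interchange (sumFrom0 n f) (sumFrom0 n g) (f (suc n)) (g (suc n)))

sumFrom0-neg : ∀ n f → sumFrom0 n (λ i → - f i) ≡ - sumFrom0 n f
sumFrom0-neg zero    f = refl
sumFrom0-neg (suc n) f = begin
  sumFrom0 n (λ i → - f i) + - f (suc n)  ≡⟨ cong (_+ - f (suc n)) (sumFrom0-neg n f) ⟩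
  - sumFrom0 n f + - f (suc n)            ≡⟨ ℤ.neg-distrib-+ (sumFrom0 n f) (f (suc n)) ⟨
  - sumFrom0 (suc n) f                    ∎

sumFrom0-zero : ∀ n → sumFrom0 n (λ _ → 0ℤ) ≡ 0ℤ
sumFrom0-zero zero    = refl
sumFrom0-zero (suc n) = cong (_+ 0ℤ) (sumFrom0-zero n)

infixl 7 _⋆_

_⋆_ : (ℕ → ℤ) → (ℕ → ℤ) → ℕ → ℤ
(f ⋆ g) n = sumFrom0 n (λ i → f i * g (n ∸ i))

⋆-suc : ∀ f g n → (f ⋆ g) (suc n) ≡ f 0 * g (suc n) + ((f ∘ suc) ⋆ g) n
⋆-suc f g n = sumFrom0-suc n (λ i → f i * g (suc n ∸ i))

[k+1]*nC[k+1]+k*nCk≡n*nCk : ∀ n k → + suc k * + (n C suc k) + + k * + (n C k) ≡ + n * + (n C k)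
[k+1]*nC[k+1]+k*nCk≡n*nCk zero    zero    = refl
[k+1]*nC[k+1]+k*nCk≡n*nCk zero    (suc k) = cong₂ _+_ (ℤ.*-zeroʳ (+ suc (suc k))) (ℤ.*-zeroʳ (+ suc k))
[k+1]*nC[k+1]+k*nCk≡n*nCk (suc n) zero    = begin
  1ℤ * + (suc n C 1) + 0ℤ  ≡⟨ ℤ.+-identityʳ _ ⟩
  1ℤ * + (suc n C 1)       ≡⟨ ℤ.*-identityˡ _ ⟩
  + (suc n C 1)            ≡⟨ cong +_ (nC1≡n (suc n)) ⟩
  + suc n                  ≡⟨ ℤ.*-identityʳ (+ suc n) ⟨
  + suc n * 1ℤ             ∎
[k+1]*nC[k+1]+k*nCk≡n*nCk (suc n) (suc k) = begin
  + suc (suc k) * + (suc n C suc (suc k)) + + suc k * + (suc n C suc k)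
    ≡⟨ cong₂ (λ a b → + suc (suc k) * a + + suc k * b) (pascal (suc k)) (pascal k) ⟨
  + suc (suc k) * (c₁ + c₂) + + suc k * (c₀ + c₁)
    ≡⟨ regroup (+ k) c₀ c₁ c₂ ⟩
  (+ suc (suc k) * c₂ + + suc k * c₁) + (+ suc k * c₁ + + k * c₀) + (c₀ + c₁)
    ≡⟨ cong₂ (λ a b → a + b + (c₀ + c₁))
             ([k+1]*nC[k+1]+k*nCk≡n*nCk n (suc k)) ([k+1]*nC[k+1]+k*nCk≡n*nCk n k) ⟩
  + n * c₁ + + n * c₀ + (c₀ + c₁)
    ≡⟨ collect (+ n) c₀ c₁ ⟩
  + suc n * (c₀ + c₁)
    ≡⟨ cong (+ suc n *_) (pascal k) ⟩
  + suc n * + (suc n C suc k) ∎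
  where
  c₀ = + (n C k)
  c₁ = + (n C suc k)
  c₂ = + (n C suc (suc k))
  pascal : ∀ i → + (n C i) + + (n C suc i) ≡ + (suc n C suc i)
  pascal i = cong +_ (nCk+nC[k+1]≡[n+1]C[k+1] n i)
  regroup : ∀ k c₀ c₁ c₂ → (1ℤ + (1ℤ + k)) * (c₁ + c₂) + (1ℤ + k) * (c₀ + c₁)
                           ≡ ((1ℤ + (1ℤ + k)) * c₂ + (1ℤ + k) * c₁) + ((1ℤ + k) * c₁ + k * c₀) + (c₀ + c₁)
  regroup = solve-∀
  collect : ∀ n c₀ c₁ → n * c₁ + n * c₀ + (c₀ + c₁) ≡ (1ℤ + n) * (c₀ + c₁)
  collect = solve-∀

closedForm-key : ∀ j z x N c₀ c₁ → N ≡ x + (1ℤ + j) * z → (1ℤ + j) * c₁ + j * c₀ ≡ N * c₀ →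
                 N * ((x + 1ℤ) * (c₀ + c₁)) ≡ (1ℤ + N) * ((x + z) * c₀ + x * c₁)
closedForm-key j z x N c₀ c₁ refl absorb =
  ∙-cancelʳ _ _ _ (trans (identity j z x c₀ c₁)
                         (cong (λ h → (1ℤ + N) * ((x + z) * c₀ + x * c₁) + z * h) absorb))
  where
  identity : ∀ j z x c₀ c₁ → let N = x + (1ℤ + j) * z in
             N * ((x + 1ℤ) * (c₀ + c₁)) + z * (N * c₀)
               ≡ (1ℤ + N) * ((x + z) * c₀ + x * c₁) + z * ((1ℤ + j) * c₁ + j * c₀)
  identity = solve-∀

closedForm-balance : ∀ j z x N A₀ A₂ c₀ c₁ → N ≡ x + (1ℤ + j) * z → (1ℤ + j) * c₁ + j * c₀ ≡ N * c₀ →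
                     N * A₂ ≡ (x + z) * c₀ →
                     N * ((1ℤ + N) * (A₀ + A₂)) + (1ℤ + N) * (x * c₁)
                       ≡ N * ((x + 1ℤ) * (c₀ + c₁)) + (1ℤ + N) * (N * A₀)
closedForm-balance j z x N A₀ A₂ c₀ c₁ hN absorb hA₂ = begin
  N * ((1ℤ + N) * (A₀ + A₂)) + (1ℤ + N) * (x * c₁)
    ≡⟨ solve (x ∷ N ∷ A₀ ∷ A₂ ∷ c₁ ∷ []) ⟩
  (1ℤ + N) * (N * A₂ + x * c₁) + (1ℤ + N) * (N * A₀)
    ≡⟨ cong (λ a → (1ℤ + N) * (a + x * c₁) + (1ℤ + N) * (N * A₀)) hA₂ ⟩
  (1ℤ + N) * ((x + z) * c₀ + x * c₁) + (1ℤ + N) * (N * A₀)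
    ≡⟨ cong (_+ (1ℤ + N) * (N * A₀)) (closedForm-key j z x N c₀ c₁ hN absorb) ⟨
  N * ((x + 1ℤ) * (c₀ + c₁)) + (1ℤ + N) * (N * A₀)
    ∎

x+1+y≡1+[x+y] : ∀ x y → (x + 1ℤ) + y ≡ 1ℤ + (x + y)
x+1+y≡1+[x+y] = solve-∀

module Rothe (z : ℕ) where

  rothe : ℤ → ℕ → ℤ
  rothe x zero    = 1ℤ
  rothe x (suc n) = antidiff (λ t → rothe (t + + z) n) x

  rothe-step : ∀ x n → rothe (x + 1ℤ) (suc n) ≡ rothe x (suc n) + rothe (x + + z) n
  rothe-step x n = antidiff-step (λ t → rothe (t + + z) n) x

  rothe-step-⋆ : ∀ x g n → (rothe (x + 1ℤ) ⋆ g) (suc n) ≡ (rothe x ⋆ g) (suc n) + (rothe (x + + z) ⋆ g) n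
  rothe-step-⋆ x g n = begin
    (rothe (x + 1ℤ) ⋆ g) (suc n)                                 ≡⟨ ⋆-suc (rothe (x + 1ℤ)) g n ⟩
    1ℤ * g (suc n) + sumFrom0 n (λ i → rothe (x + 1ℤ) (suc i) * g (n ∸ i))
      ≡⟨ cong (_+_ (1ℤ * g (suc n))) (sumFrom0-cong n termwise) ⟩
    1ℤ * g (suc n) + sumFrom0 n (λ i → rothe x (suc i) * g (n ∸ i) + rothe (x + + z) i * g (n ∸ i))
      ≡⟨ cong (_+_ (1ℤ * g (suc n))) (sumFrom0-+ n _ _) ⟩
    1ℤ * g (suc n) + (((rothe x ∘ suc) ⋆ g) n + (rothe (x + + z) ⋆ g) n)
      ≡⟨ ℤ.+-assoc (1ℤ * g (suc n)) _ _ ⟨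
    (1ℤ * g (suc n) + ((rothe x ∘ suc) ⋆ g) n) + (rothe (x + + z) ⋆ g) n
      ≡⟨ cong (_+ (rothe (x + + z) ⋆ g) n) (⋆-suc (rothe x) g n) ⟨
    (rothe x ⋆ g) (suc n) + (rothe (x + + z) ⋆ g) n              ∎
    where
    termwise : ∀ i → rothe (x + 1ℤ) (suc i) * g (n ∸ i)
                       ≡ rothe x (suc i) * g (n ∸ i) + rothe (x + + z) i * g (n ∸ i)
    termwise i = trans (cong (_* g (n ∸ i)) (rothe-step x i))
                       (ℤ.*-distribʳ-+ (g (n ∸ i)) (rothe x (suc i)) (rothe (x + + z) i))

  rothe-convolution : ∀ n x y → rothe (x + y) n ≡ (rothe x ⋆ rothe y) n
  rothe-convolution zero    x y = refl
  rothe-convolution (suc n) = ℤ-induction P base up down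
    where
    P : ℤ → Set
    P x = ∀ y → rothe (x + y) (suc n) ≡ (rothe x ⋆ rothe y) (suc n)

    base : P 0ℤ
    base y = begin
      rothe (0ℤ + y) (suc n)                             ≡⟨ cong (λ t → rothe t (suc n)) (ℤ.+-identityˡ y) ⟩
      rothe y (suc n)                                    ≡⟨ ℤ.*-identityˡ (rothe y (suc n)) ⟨
      1ℤ * rothe y (suc n)                               ≡⟨ ℤ.+-identityʳ _ ⟨
      1ℤ * rothe y (suc n) + 0ℤ                          ≡⟨ cong (_+_ (1ℤ * rothe y (suc n))) (sumFrom0-zero n) ⟨
      1ℤ * rothe y (suc n) + sumFrom0 n (λ _ → 0ℤ)       ≡⟨ ⋆-suc (rothe 0ℤ) (rothe y) n ⟨
      (rothe 0ℤ ⋆ rothe y) (suc n)                       ∎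

    shift : ∀ x y → rothe ((x + 1ℤ) + y) (suc n) ≡ rothe (x + y) (suc n) + (rothe (x + + z) ⋆ rothe y) n
    shift x y = begin
      rothe ((x + 1ℤ) + y) (suc n)                         ≡⟨ cong (λ t → rothe t (suc n)) (x+1+y≡x+y+1 x y) ⟩
      rothe ((x + y) + 1ℤ) (suc n)                         ≡⟨ rothe-step (x + y) n ⟩
      rothe (x + y) (suc n) + rothe ((x + y) + + z) n      ≡⟨ cong (λ t → rothe (x + y) (suc n) + rothe t n) (x+y+z≡x+z+y x y (+ z)) ⟩
      rothe (x + y) (suc n) + rothe ((x + + z) + y) n      ≡⟨ cong (_+_ (rothe (x + y) (suc n))) (rothe-convolution n (x + + z) y) ⟩
      rothe (x + y) (suc n) + (rothe (x + + z) ⋆ rothe y) n ∎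
      where
      x+1+y≡x+y+1 : ∀ x y → (x + 1ℤ) + y ≡ (x + y) + 1ℤ
      x+1+y≡x+y+1 = solve-∀
      x+y+z≡x+z+y : ∀ x y z → (x + y) + z ≡ (x + z) + y
      x+y+z≡x+z+y = solve-∀

    up : ∀ m → P (+ m) → P (+ m + 1ℤ)
    up m ih y = begin
      rothe ((+ m + 1ℤ) + y) (suc n)                                    ≡⟨ shift (+ m) y ⟩
      rothe (+ m + y) (suc n) + (rothe (+ m + + z) ⋆ rothe y) n          ≡⟨ cong (_+ (rothe (+ m + + z) ⋆ rothe y) n) (ih y) ⟩
      (rothe (+ m) ⋆ rothe y) (suc n) + (rothe (+ m + + z) ⋆ rothe y) n  ≡⟨ rothe-step-⋆ (+ m) (rothe y) n ⟨
      (rothe (+ m + 1ℤ) ⋆ rothe y) (suc n)                               ∎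

    down : ∀ m → P (-[1+ m ] + 1ℤ) → P -[1+ m ]
    down m ih y = ∙-cancelʳ ((rothe (x + + z) ⋆ rothe y) n) _ _ (begin
      rothe (x + y) (suc n) + (rothe (x + + z) ⋆ rothe y) n        ≡⟨ shift x y ⟨
      rothe ((x + 1ℤ) + y) (suc n)                                 ≡⟨ ih y ⟩
      (rothe (x + 1ℤ) ⋆ rothe y) (suc n)                           ≡⟨ rothe-step-⋆ x (rothe y) n ⟩
      (rothe x ⋆ rothe y) (suc n) + (rothe (x + + z) ⋆ rothe y) n  ∎)
      where x = -[1+ m ]

  rothe-recurrence : ∀ x n → rothe x (suc n) ≡ sumFrom0 n (λ j → (- rothe (- x) (suc j)) * rothe x (n ∸ j))
  rothe-recurrence x n = begin
    rothe x (suc n)                         ≡⟨ inverseˡ-unique _ _ r+S≡0 ⟩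
    - S                                     ≡⟨ sumFrom0-neg n _ ⟨
    sumFrom0 n (λ j → - (rothe (- x) (suc j) * rothe x (n ∸ j)))
      ≡⟨ sumFrom0-cong n (λ j → ℤ.neg-distribˡ-* (rothe (- x) (suc j)) _) ⟩
    sumFrom0 n (λ j → (- rothe (- x) (suc j)) * rothe x (n ∸ j)) ∎
    where
    S = ((rothe (- x) ∘ suc) ⋆ rothe x) n
    r+S≡0 : rothe x (suc n) + S ≡ 0ℤ
    r+S≡0 = begin
      rothe x (suc n) + S                 ≡⟨ cong (_+ S) (ℤ.*-identityˡ (rothe x (suc n))) ⟨
      1ℤ * rothe x (suc n) + S            ≡⟨ ⋆-suc (rothe (- x)) (rothe x) n ⟨
      (rothe (- x) ⋆ rothe x) (suc n)     ≡⟨ rothe-convolution (suc n) (- x) x ⟨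
      rothe (- x + x) (suc n)             ≡⟨ cong (λ t → rothe t (suc n)) (ℤ.+-inverseˡ x) ⟩
      0ℤ                                  ∎

  module _ .{{_ : NonZero z}} where

    -- A_j(x) = x/N · C(N, j) with N = x + jz, cleared of its denominator; it is only claimed for N ≥ 0.
    rothe-closedForm : ∀ j x N → + N ≡ x + + j * + z → + N * rothe x j ≡ x * + (N C j)
    rothe-closedForm zero    x N hN = begin
      + N * 1ℤ  ≡⟨ ℤ.*-identityʳ (+ N) ⟩
      + N       ≡⟨ hN ⟩
      x + 0ℤ    ≡⟨ ℤ.+-identityʳ x ⟩
      x         ≡⟨ ℤ.*-identityʳ x ⟨
      x * 1ℤ    ∎
    rothe-closedForm (suc j) = ℤ-induction P base up down
      where
      P : ℤ → Set
      P x = ∀ N → + N ≡ x + + suc j * + z → + N * rothe x (suc j) ≡ x * + (N C suc j)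

      base : P 0ℤ
      base N _ = ℤ.*-zeroʳ (+ N)

      -- Given the case j at x + z, the claim at x holds iff it holds at x + 1.
      step : ∀ x N → + N ≡ x + + suc j * + z →
             + N * (+ suc N * rothe (x + 1ℤ) (suc j)) + + suc N * (x * + (N C suc j))
               ≡ + N * ((x + 1ℤ) * + (suc N C suc j)) + + suc N * (+ N * rothe x (suc j))
      step x N hN = begin
        + N * (+ suc N * rothe (x + 1ℤ) (suc j)) + + suc N * (x * + (N C suc j))
          ≡⟨ cong (λ a → + N * (+ suc N * a) + + suc N * (x * + (N C suc j))) (rothe-step x j) ⟩
        + N * (+ suc N * (rothe x (suc j) + rothe (x + + z) j)) + + suc N * (x * + (N C suc j))
          ≡⟨ closedForm-balance (+ j) (+ z) x (+ N) _ _ _ _ hN ([k+1]*nC[k+1]+k*nCk≡n*nCk N j)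
               (rothe-closedForm j (x + + z) N (trans hN (x+[1+j]z≡x+z+jz x (+ j) (+ z)))) ⟩
        + N * ((x + 1ℤ) * + (N C j ℕ.+ N C suc j)) + + suc N * (+ N * rothe x (suc j))
          ≡⟨ cong (λ c → + N * ((x + 1ℤ) * + c) + + suc N * (+ N * rothe x (suc j))) (nCk+nC[k+1]≡[n+1]C[k+1] N j) ⟩
        + N * ((x + 1ℤ) * + (suc N C suc j)) + + suc N * (+ N * rothe x (suc j)) ∎
        where
        x+[1+j]z≡x+z+jz : ∀ x j z → x + (1ℤ + j) * z ≡ (x + z) + j * z
        x+[1+j]z≡x+z+jz = solve-∀

      N′ : ℕ → ℕ
      N′ p = p ℕ.+ suc j ℕ.* z

      hN′ : ∀ p → + N′ p ≡ + p + + suc j * + z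
      hN′ p = cong (_+_ (+ p)) (ℤ.pos-* (suc j) z)

      -- The only use of z ≠ 0: the upward step has to cancel N′ = p + (j+1)z.
      N′≢0 : ∀ p → NonZero (N′ p)
      N′≢0 p = ℕ.≢-nonZero (ℕ.≢-nonZero⁻¹ (suc j ℕ.* z) {{ℕ.m*n≢0 (suc j) z}} ∘ ℕ.m+n≡0⇒n≡0 p)

      up : ∀ p → P (+ p) → P (+ p + 1ℤ)
      up p ih N hN with ℤ.+-injective (trans hN (trans (x+1+y≡1+[x+y] (+ p) (+ suc j * + z))
                                                        (cong (_+_ 1ℤ) (sym (hN′ p)))))
      ... | refl = ℤ.*-cancelˡ-≡ (+ N′ p) _ _ {{N′≢0 p}} (∙-cancelʳ T _ _ (begin
        + N′ p * (+ N * rothe (+ p + 1ℤ) (suc j)) + T      ≡⟨ step (+ p) (N′ p) (hN′ p) ⟩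
        + N′ p * R + + N * (+ N′ p * rothe (+ p) (suc j))  ≡⟨ cong (λ a → + N′ p * R + + N * a) (ih (N′ p) (hN′ p)) ⟩
        + N′ p * R + T                                     ∎))
        where
        T = + N * (+ p * + (N′ p C suc j))
        R = (+ p + 1ℤ) * + (N C suc j)

      down : ∀ p → P (-[1+ p ] + 1ℤ) → P -[1+ p ]
      down p ih N hN = sym (ℤ.*-cancelˡ-≡ (+ suc N) _ _ (∙-cancelˡ (+ N * R) _ _ (begin
        + N * R + + suc N * (x * + (N C suc j))
          ≡⟨ cong (λ a → + N * a + + suc N * (x * + (N C suc j))) (ih (suc N) hN₊) ⟨
        + N * (+ suc N * rothe (x + 1ℤ) (suc j)) + + suc N * (x * + (N C suc j))
          ≡⟨ step x N hN ⟩
        + N * R + + suc N * (+ N * rothe x (suc j))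
          ∎)))
        where
        x = -[1+ p ]
        R = (x + 1ℤ) * + (suc N C suc j)
        hN₊ : + suc N ≡ (x + 1ℤ) + + suc j * + z
        hN₊ = trans (cong (_+_ 1ℤ) hN) (sym (x+1+y≡1+[x+y] x (+ suc j * + z)))

fromℚᵘ-homo-+ : ∀ p q → fromℚᵘ (p ℚᵘ.+ q) ≡ fromℚᵘ p ℚ+ fromℚᵘ q
fromℚᵘ-homo-+ p q = ℚ.toℚᵘ-injective (ℚᵘ.≃-trans (ℚ.toℚᵘ-fromℚᵘ (p ℚᵘ.+ q)) (ℚᵘ.≃-sym
  (ℚᵘ.≃-trans (ℚ.toℚᵘ-homo-+ (fromℚᵘ p) (fromℚᵘ q)) (ℚᵘ.+-cong (ℚ.toℚᵘ-fromℚᵘ p) (ℚ.toℚᵘ-fromℚᵘ q)))))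

fromℚᵘ-homo-* : ∀ p q → fromℚᵘ (p ℚᵘ.* q) ≡ fromℚᵘ p ℚ* fromℚᵘ q
fromℚᵘ-homo-* p q = ℚ.toℚᵘ-injective (ℚᵘ.≃-trans (ℚ.toℚᵘ-fromℚᵘ (p ℚᵘ.* q)) (ℚᵘ.≃-sym
  (ℚᵘ.≃-trans (ℚ.toℚᵘ-homo-* (fromℚᵘ p) (fromℚᵘ q)) (ℚᵘ.*-cong (ℚ.toℚᵘ-fromℚᵘ p) (ℚ.toℚᵘ-fromℚᵘ q)))))

fromℤ : ℤ → ℚ
fromℤ i = i / 1

fromℤ-+ : ∀ i j → fromℤ (i + j) ≡ fromℤ i ℚ+ fromℤ j
fromℤ-+ i j = trans (cong fromℤ (sym (cong₂ _+_ (ℤ.*-identityʳ i) (ℤ.*-identityʳ j))))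
                    (fromℚᵘ-homo-+ (mkℚᵘ i 0) (mkℚᵘ j 0))

fromℤ-* : ∀ i j → fromℤ (i * j) ≡ fromℤ i ℚ* fromℤ j
fromℤ-* i j = fromℚᵘ-homo-* (mkℚᵘ i 0) (mkℚᵘ j 0)

/-cross : ∀ i j c d → i * + suc d ≡ j * + suc c → i / suc c ≡ j / suc d
/-cross i j c d eq = ℚ.fromℚᵘ-cong {mkℚᵘ i c} {mkℚᵘ j d} (*≡* eq)

/-*-fromℤ : ∀ c d a b → c * a ≡ + suc d * b → (c / suc d) ℚ* fromℤ a ≡ fromℤ b
/-*-fromℤ c d a b eq =
  trans (sym (fromℚᵘ-homo-* (mkℚᵘ c d) (mkℚᵘ a 0))) (/-cross (c * a) b (d ℕ.* 1) 0 (begin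
  (c * a) * 1ℤ          ≡⟨ ℤ.*-identityʳ (c * a) ⟩
  c * a                 ≡⟨ eq ⟩
  + suc d * b           ≡⟨ ℤ.*-comm (+ suc d) b ⟩
  b * + suc d           ≡⟨ cong (λ e → b * + suc e) (ℕ.*-identityʳ d) ⟨
  b * + suc (d ℕ.* 1)   ∎))

sumFrom1-fromℤ : ∀ n (f : ℕ → ℚ) (g : ℕ → ℤ) → (∀ j → f (suc j) ≡ fromℤ (g j)) →
                 sumFrom1 (suc n) f ≡ fromℤ (sumFrom0 n g)
sumFrom1-fromℤ zero    f g f≗g = trans (ℚ.+-identityˡ (f 1)) (f≗g 0)
sumFrom1-fromℤ (suc n) f g f≗g = trans (cong₂ _ℚ+_ (sumFrom1-fromℤ n f g f≗g) (f≗g (suc n)))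
                                       (sym (fromℤ-+ (sumFrom0 n g) (g (suc n))))

coefficient-identity : ∀ k s m N a r c c′ → N ≡ s * k → N * a ≡ (- k) * c′ →
                       (1ℤ + m) * c′ + m * c ≡ N * c → s * r ≡ c →
                       N * ((1ℤ + m) * (- a)) ≡ N * ((N - m) * r)
coefficient-identity k s m N a r c c′ hN hNa absorb hsr = begin
  N * ((1ℤ + m) * (- a))                   ≡⟨ solve (m ∷ N ∷ a ∷ []) ⟩
  - ((1ℤ + m) * (N * a))                   ≡⟨ cong (λ t → - ((1ℤ + m) * t)) hNa ⟩
  - ((1ℤ + m) * ((- k) * c′))              ≡⟨ solve (k ∷ m ∷ c ∷ c′ ∷ []) ⟩
  k * ((1ℤ + m) * c′ + m * c) - k * (m * c) ≡⟨ cong (λ t → k * t - k * (m * c)) absorb ⟩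
  k * (N * c) - k * (m * c)                ≡⟨ solve (k ∷ m ∷ N ∷ c ∷ []) ⟩
  k * ((N - m) * c)                        ≡⟨ cong (λ t → k * ((N - m) * t)) hsr ⟨
  k * ((N - m) * (s * r))                  ≡⟨ solve (k ∷ s ∷ m ∷ N ∷ r ∷ []) ⟩
  (s * k) * ((N - m) * r)                  ≡⟨ cong (_* ((N - m) * r)) hN ⟨
  N * ((N - m) * r)                        ∎

module Ck2ViaRothe (k : ℕ) .{{_ : NonZero k}} where
  open Rothe (2 ℕ.* k)

  instance
    2k≢0 : NonZero (2 ℕ.* k)
    2k≢0 = ℕ.m*n≢0 2 k

  rothe-at-k : ∀ j → + suc (2 ℕ.* j) * rothe (+ k) j ≡ + ((suc (2 ℕ.* j) ℕ.* k) C j)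
  rothe-at-k j = ℤ.*-cancelˡ-≡ (+ k) _ _ (begin
    + k * (+ s * rothe (+ k) j)     ≡⟨ x∙yz≈yx∙z (+ k) (+ s) (rothe (+ k) j) ⟩
    (+ s * + k) * rothe (+ k) j     ≡⟨ cong (_* rothe (+ k) j) (ℤ.pos-* s k) ⟨
    + (s ℕ.* k) * rothe (+ k) j     ≡⟨ rothe-closedForm j (+ k) (s ℕ.* k) (trans (ℤ.pos-* s k) ([1+2j]k≡k+j[2k] (+ j) (+ k))) ⟩
    + k * + ((s ℕ.* k) C j)         ∎)
    where
    s = suc (2 ℕ.* j)
    [1+2j]k≡k+j[2k] : ∀ j k → (1ℤ + (j + (j + 0ℤ))) * k ≡ k + j * (k + (k + 0ℤ))
    [1+2j]k≡k+j[2k] = solve-∀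

  rothe-at-−k : ∀ m → + suc m * (- rothe (- + k) (suc m)) ≡ (+ (suc (2 ℕ.* m) ℕ.* k) - + m) * rothe (+ k) m
  rothe-at-−k m = ℤ.*-cancelˡ-≡ (+ N) _ _ {{ℕ.m*n≢0 s k}}
    (coefficient-identity (+ k) (+ s) (+ m) (+ N) _ _ _ _ (ℤ.pos-* s k)
      (rothe-closedForm (suc m) (- + k) N (trans (ℤ.pos-* s k) ([1+2m]k≡-k+[1+m][2k] (+ m) (+ k))))
      ([k+1]*nC[k+1]+k*nCk≡n*nCk N m) (rothe-at-k m))
    where
    s = suc (2 ℕ.* m)
    N = s ℕ.* k
    [1+2m]k≡-k+[1+m][2k] : ∀ m k → (1ℤ + (m + (m + 0ℤ))) * k ≡ - k + (1ℤ + m) * (k + (k + 0ℤ))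
    [1+2m]k≡-k+[1+m][2k] = solve-∀

  Ck2≡rothe : ∀ j → Ck2 k j ≡ fromℤ (rothe (+ k) j)
  Ck2≡rothe j = /-cross (+ c) (rothe (+ k) j) (2 ℕ.* j) 0 (begin
    + c * 1ℤ                          ≡⟨ ℤ.*-identityʳ (+ c) ⟩
    + c                               ≡⟨ rothe-at-k j ⟨
    + suc (2 ℕ.* j) * rothe (+ k) j   ≡⟨ ℤ.*-comm (+ suc (2 ℕ.* j)) _ ⟩
    rothe (+ k) j * + suc (2 ℕ.* j)   ∎)
    where c = (suc (2 ℕ.* j) ℕ.* k) C j

  coeff*Ck2≡rothe : ∀ m → coeff k (suc m) ℚ* Ck2 k m ≡ fromℤ (- rothe (- + k) (suc m))
  coeff*Ck2≡rothe m = trans (cong (coeff k (suc m) ℚ*_) (Ck2≡rothe m))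
    (/-*-fromℤ (+ (suc (2 ℕ.* m) ℕ.* k) - + m) m (rothe (+ k) m) (- rothe (- + k) (suc m)) (sym (rothe-at-−k m)))

  recurrence : ∀ n → Ck2 k (suc n) ≡ sumFrom1 (suc n) (λ i → coeff k i ℚ* Ck2 k (i ∸ 1) ℚ* Ck2 k (suc n ∸ i))
  recurrence n = begin
    Ck2 k (suc n)                                                              ≡⟨ Ck2≡rothe (suc n) ⟩
    fromℤ (rothe (+ k) (suc n))                                                ≡⟨ cong fromℤ (rothe-recurrence (+ k) n) ⟩
    fromℤ (sumFrom0 n term)                                                    ≡⟨ sumFrom1-fromℤ n _ term term≡ ⟨
    sumFrom1 (suc n) (λ i → coeff k i ℚ* Ck2 k (i ∸ 1) ℚ* Ck2 k (suc n ∸ i))  ∎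
    where
    term : ℕ → ℤ
    term j = (- rothe (- + k) (suc j)) * rothe (+ k) (n ∸ j)
    term≡ : ∀ j → coeff k (suc j) ℚ* Ck2 k j ℚ* Ck2 k (n ∸ j) ≡ fromℤ (term j)
    term≡ j = trans (cong₂ _ℚ*_ (coeff*Ck2≡rothe j) (Ck2≡rothe (n ∸ j)))
                    (sym (fromℤ-* (- rothe (- + k) (suc j)) (rothe (+ k) (n ∸ j))))

lemma4p3 : (k : ℕ) → k ≥ 1 → (n : ℕ) → n ≥ 1 →
    Ck2 k n ≡ sumFrom1 n (λ i → coeff k i ℚ* Ck2 k (i ∸ 1) ℚ* Ck2 k (n ∸ i))
lemma4p3 k k≥1 (suc n) _ = Ck2ViaRothe.recurrence k {{ℕ.>-nonZero k≥1}} n
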